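{- $\Delta_{\mathbf{1}}\leq\mathfrak{s}_{\text{mix}}$.
   Context: Let $\square$ be the set of all $f\in\omega^\omega$ without fixed points. $\Delta_{\mathbf{1}}$ is the least size of a family $\mathcal{F}\subseteq\square$ such that for every $A\in[\omega]^\omega$ there is $f\in\mathcal{F}$ with $f[A]\cap A$ infinite. Let $\mathbf{P}$ be the family of partitions of $\omega$ into countably infinitely many infinite sets; $\mathfrak{s}_{\text{mix}}$ is the least size of $\mathcal{S}\subseteq\mathbf{P}$ such that for every $A\in[\omega]^\omega$ there is $(P_k)_{k\in\omega}\in\mathcal{S}$ with $A\cap P_k$ infinite for every $k$. -}

module Defs where

open import Data.Nat using (ℕ; _≤_)
open import Data.Bool using (Bool; true)
open import Data.Product using (Σ; ∃; _×_)
open import Relation.Binary.PropositionalEquality using (_≡_; _≢_)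
open import Function.Bundles using (_↣_)

Subset : Set
Subset = ℕ → Bool

_∈_ : ℕ → Subset → Set
n ∈ A = A n ≡ true

InfinitelyMany : (ℕ → Set) → Set
InfinitelyMany P = ∀ n → ∃ λ m → n ≤ m × P m

InfiniteSet : Subset → Set
InfiniteSet A = InfinitelyMany (λ m → m ∈ A)

NoFixedPoint : (ℕ → ℕ) → Set
NoFixedPoint f = ∀ n → f n ≢ n

ImageMeetsInfinitely : (ℕ → ℕ) → Subset → Set
ImageMeetsInfinitely f A =
  InfinitelyMany (λ m → m ∈ A × (∃ λ a → a ∈ A × f a ≡ m))

-- An element of 𝐏: a partition (P_k)_{k∈ω} of ω into infinitely many
-- infinite pieces, given by the piece-label function: P_k = label⁻¹(k).
record Partition : Set where
  field
    label    : ℕ → ℕ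
    pieceInf : ∀ k → InfinitelyMany (λ m → label m ≡ k)

open Partition public

Mixes : Partition → Subset → Set
Mixes P A = ∀ k → InfinitelyMany (λ m → m ∈ A × label P m ≡ k)

IsMixFamily : {I : Set} → (I → Partition) → Set
IsMixFamily {I} S = ∀ A → InfiniteSet A → ∃ λ (i : I) → Mixes (S i) A

IsDelta1Family : {J : Set} → (J → ℕ → ℕ) → Set
IsDelta1Family {J} F =
  (∀ j → NoFixedPoint (F j)) ×
  (∀ A → InfiniteSet A → ∃ λ (j : J) → ImageMeetsInfinitely (F j) A)

{-# OPTIONS --safe #-}
module Submission where

open import Defs
open import Data.Nat using (ℕ; suc)
open import Data.Nat.Properties using (_≟_; 1+n≢n; >⇒≢)
open import Data.Product using (Σ; ∃; _×_; _,_)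
open import Function.Bundles using (_↣_)
open import Function.Construct.Identity using (↣-id)
open import Relation.Nullary using (yes; no; contradiction)
open import Relation.Binary.PropositionalEquality using (_≡_; _≢_; refl; sym; trans)

-- Every partition in a mixing family yields one fixed-point-free function, so
-- the Δ₁ family can be indexed by the same set. The function sends n to the
-- index of the piece containing n (or to n + 1 if that index is n). If A meets
-- every piece infinitely often, then each m lies in f[A]: pick a ∈ A with
-- a > m in the m-th piece, so a is no fixed point of the labelling and f a = m.
-- Hence f[A] ∩ A ⊇ A is infinite.

shiftFixedPoints : (ℕ → ℕ) → ℕ → ℕ
shiftFixedPoints g n with g n ≟ n
... | yes _ = suc n
... | no  _ = g n

shiftFixedPoints-noFixedPoint : ∀ g → NoFixedPoint (shiftFixedPoints g)
shiftFixedPoints-noFixedPoint g n with g n ≟ n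
... | yes _    = 1+n≢n
... | no  gn≢n = gn≢n

shiftFixedPoints-agrees : ∀ g {n} → g n ≢ n → shiftFixedPoints g n ≡ g n
shiftFixedPoints-agrees g {n} gn≢n with g n ≟ n
... | yes gn≡n = contradiction gn≡n gn≢n
... | no  _    = refl

_⊆_[_] : Subset → (ℕ → ℕ) → Subset → Set
B ⊆ f [ A ] = ∀ {m} → m ∈ B → ∃ λ a → a ∈ A × f a ≡ m

⊆image⇒imageMeetsInfinitely : ∀ {f A} → InfiniteSet A → A ⊆ f [ A ] →
                              ImageMeetsInfinitely f A
⊆image⇒imageMeetsInfinitely infA A⊆f[A] n with infA n
... | m , n≤m , m∈A = m , n≤m , m∈A , A⊆f[A] m∈A

mixes⇒⊆image : ∀ P {A} → Mixes P A → A ⊆ shiftFixedPoints (label P) [ A ]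
mixes⇒⊆image P mixes {m} _ with mixes m (suc m)
... | a , m<a , a∈A , la≡m =
  a , a∈A , trans (shiftFixedPoints-agrees (label P) la≢a) la≡m
  where
  la≢a : label P a ≢ a
  la≢a la≡a = >⇒≢ m<a (trans (sym la≡a) la≡m)

mixFamily⇒delta1Family : ∀ {I} {S : I → Partition} → IsMixFamily S →
                         IsDelta1Family (λ i → shiftFixedPoints (label (S i)))
mixFamily⇒delta1Family {S = S} mix =
  (λ i → shiftFixedPoints-noFixedPoint (label (S i))) , hits
  where
  hits : ∀ A → InfiniteSet A →
         ∃ λ i → ImageMeetsInfinitely (shiftFixedPoints (label (S i))) A
  hits A infA with mix A infA
  ... | i , mixes = i , ⊆image⇒imageMeetsInfinitely infA (mixes⇒⊆image (S i) mixes)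

mainTheorem4 : (I : Set) (S : I → Partition) → IsMixFamily S →
    Σ Set λ J → (J ↣ I) × (∃ λ (F : J → ℕ → ℕ) → IsDelta1Family F)
mainTheorem4 I S mix =
  I , ↣-id I , (λ i → shiftFixedPoints (label (S i))) , mixFamily⇒delta1Family {S = S} mix
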